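{- Let $P$ be a poset on $[n]$, $\tau\in\mathfrak{S}^{\pitchfork}(P)$, and $\sigma=\Phi(\tau)\in\mathcal{L}(P)$. Then for every $k\ge1$, the set of elements of Level $k$ for $\tau$ equals the set of elements of Level $k$ for $\sigma$.
   Context: $\mathfrak{S}^{\pitchfork}(P)$: permutations $\tau$ of $[n]$ whose cycle partition $\pi$ has all blocks antichains of $P$ and such that the preposet $P/\pi$ on blocks (transitive closure of $B\le B'$ whenever some $p\in B,q\in B'$ have $p\le_Pq$) is a poset. $\mathcal{L}(P)$: linear extensions of $P$ (permutations $[\sigma_1,\dots,\sigma_n]$ with $i<_Pj$ implying $i$ precedes $j$). Levels for $\tau$: blocks minimal in $P/\pi$ have Level 1; for $k\ge2$ the Level $k$ blocks are the minimal ones after deleting all blocks of Level $<k$; an element has the Level of its block. Essential elements of $\tau$: all Level 1 elements, and Level $k\ge 2$ elements $x$ with $x>_Py$ for some $y$ of Level $k-1$. $\Phi(\tau)$: write the cycles of $\tau$ with cycles of lower Level before those of higher Level, each cycle starting with its largest essential element, and cycles within a Level ordered by increasing first element; erase parentheses. Levels for $\sigma\in\mathcal{L}(P)$: Level 1 consists of the entries of the longest initial segment $\sigma_1,\dots,\sigma_r$ that is an antichain of $P$; if Levels $1,\dots,k-1$ consist of $\sigma_1,\dots,\sigma_t$, Level $k$ consists of the entries of the longest initial segment of $\sigma_{t+1},\dots,\sigma_n$ that is an antichain of $P$. -}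

module Defs where

open import Level using (0ℓ)
open import Data.Nat as ℕ using (ℕ; zero; suc)
open import Data.Fin as Fin using (Fin)
open import Data.Fin.Properties using (_≟_)
open import Data.Fin.Permutation using (Permutation′; _⟨$⟩ʳ_)
open import Data.List using (List; []; _∷_; _++_; [_]; map; takeWhile; concatMap)
open import Data.List.Membership.Propositional using (_∈_)
open import Data.List.Relation.Unary.All using (All; all?)
open import Data.List.Relation.Unary.Any using (Any)
open import Data.List.Relation.Unary.AllPairs using (AllPairs)
open import Data.Product using (Σ; ∃; ∃-syntax; _×_; _,_)
open import Data.Sum using (_⊎_)
open import Data.Empty using (⊥)
open import Relation.Nullary using (¬_; Dec; yes; no; ¬?)
open import Relation.Nullary.Decidable using (_×-dec_)
open import Relation.Binary using (Rel; Decidable; IsPartialOrder)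
open import Relation.Binary.PropositionalEquality using (_≡_)
open import Relation.Binary.Construct.Closure.ReflexiveTransitive using (Star)

record FinPoset (n : ℕ) : Set₁ where
  field
    _≤P_           : Rel (Fin n) 0ℓ
    isPartialOrder : IsPartialOrder _≡_ _≤P_
    _≤P?_          : Decidable _≤P_

  _<P_ : Rel (Fin n) 0ℓ
  x <P y = x ≤P y × ¬ (x ≡ y)

  Incomparable : Rel (Fin n) 0ℓ
  Incomparable x y = ¬ (x ≤P y) × ¬ (y ≤P x)

  incomparable? : Decidable Incomparable
  incomparable? x y = ¬? (x ≤P? y) ×-dec ¬? (y ≤P? x)

open FinPoset public

iter : {A : Set} → (A → A) → ℕ → A → A
iter f zero    x = x
iter f (suc k) x = f (iter f k x)

module _ {n : ℕ} (τ : Permutation′ n) where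

  -- x and y lie in the same cycle of τ (the cycle partition π)
  SameCycle : Rel (Fin n) 0ℓ
  SameCycle x y = ∃[ k ] iter (τ ⟨$⟩ʳ_) k x ≡ y

  -- the cycle of τ containing e, written starting at e:
  -- e, τ e, τ² e, ... up to (not including) the return to e
  cycleWord : Fin n → List (Fin n)
  cycleWord e =
    e ∷ takeWhile (λ y → ¬? (y ≟ e))
                  (map (λ k → iter (τ ⟨$⟩ʳ_) (suc k) e) (Data.List.upTo n))

module _ {n : ℕ} (P : FinPoset n) (τ : Permutation′ n) where

  -- generating relation of P/π, lifted to elements:
  -- block(x) ≤ block(y) whenever some x' ∈ block(x), y' ∈ block(y) have x' ≤P y'
  QStep : Rel (Fin n) 0ℓ
  QStep x y = ∃[ x' ] ∃[ y' ] (SameCycle τ x x' × SameCycle τ y y' × _≤P_ P x' y')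

  _≼_ : Rel (Fin n) 0ℓ
  _≼_ = Star QStep

  _≺_ : Rel (Fin n) 0ℓ
  x ≺ y = x ≼ y × ¬ (y ≼ x)

  -- τ ∈ 𝔖^⋔(P): blocks are antichains and P/π is a poset (antisymmetric)
  InSPitchfork : Set
  InSPitchfork =
    (∀ x y → SameCycle τ x y → _≤P_ P x y → x ≡ y) ×
    (∀ x y → x ≼ y → y ≼ x → SameCycle τ x y)

  -- DeletedT k x : x has Level ≤ k (for τ)
  DeletedT : ℕ → Fin n → Set
  LevelT : ℕ → Fin n → Set

  DeletedT zero    x = ⊥
  DeletedT (suc k) x = DeletedT k x ⊎ LevelT (suc k) x

  LevelT zero    x = ⊥
  LevelT (suc k) x = ¬ DeletedT k x × (∀ y → y ≺ x → DeletedT k y)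

  Essential : Fin n → Set
  Essential x =
    LevelT 1 x ⊎
    (∃[ k ] (LevelT (suc (suc k)) x × ∃[ y ] (LevelT (suc k) y × _<P_ P y x)))

  IsLeader : Fin n → Set
  IsLeader e = Essential e × (∀ y → SameCycle τ e y → Essential y → y Fin.≤ e)

  WrittenBefore : Rel (Fin n) 0ℓ
  WrittenBefore e₁ e₂ = ∀ k₁ k₂ → LevelT k₁ e₁ → LevelT k₂ e₂ →
                        (k₁ ℕ.< k₂) ⊎ (k₁ ≡ k₂ × e₁ Fin.< e₂)

  IsΦ : List (Fin n) → Set
  IsΦ σ = ∃[ es ] ( σ ≡ concatMap (cycleWord τ) es
                  × All IsLeader es
                  × (∀ x → Any (SameCycle τ x) es)
                  × AllPairs WrittenBefore es )

-- Levels for a sequence σ: successive longest initial antichain segments.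
-- (Antichain-ness is prefix-closed, so the longest initial antichain segment
-- is obtained by adding entries while each new one is incomparable to all
-- previous entries of the current segment.)

module _ {n : ℕ} (P : FinPoset n) where

  levelsGo : List (Fin n) → List (Fin n) → List (List (Fin n))
  levelsGo acc []       = acc ∷ []
  levelsGo acc (x ∷ xs) with all? (incomparable? P x) acc
  ... | yes _ = levelsGo (acc ++ [ x ]) xs
  ... | no  _ = acc ∷ levelsGo [ x ] xs

  levelsL : List (Fin n) → List (List (Fin n))
  levelsL []       = []
  levelsL (x ∷ xs) = levelsGo [ x ] xs

  nth : List (List (Fin n)) → ℕ → List (Fin n)
  nth []       _       = []
  nth (b ∷ bs) zero    = b
  nth (b ∷ bs) (suc k) = nth bs k

  -- LevelS σ k x : x has Level k for σ (Levels numbered from 1; Level 0 empty)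
  LevelS : List (Fin n) → ℕ → Fin n → Set
  LevelS σ zero    x = ⊥
  LevelS σ (suc k) x = x ∈ nth (levelsL σ) k

-- Φ(τ) writes the cycles of τ Level by Level, so along σ the τ-Level never decreases. Two distinct
-- elements of the same τ-Level are incomparable: if a <P b, the block of a lies below that of b, so by
-- minimality both lie in one block, which is an antichain. A cycle of Level k ≥ 2 starts with an
-- essential element, which lies above an element of Level k - 1. Hence the greedy scan defining the
-- Levels of σ extends its current antichain exactly while the τ-Level stays constant and closes it
-- exactly where the τ-Level rises, always by one; so its k-th segment is the τ-Level k.

module Submission where

open import Defs
open import Level using (0ℓ)
open import Data.Nat using (ℕ; zero; suc; _+_; _*_; _≤_; _<_; z≤n; s≤s; z<s)
open import Data.Nat.Properties
  using (<-cmp; ≤-refl; ≤-reflexive; ≤-trans; ≤-pred; <⇒≤; <⇒≱; <-irrefl; m≤n⇒m<n∨m≡n; m≤n+m; +-suc; +-comm; *-suc; m≢1+n+m; m≤n⇒∃[o]m+o≡n; n<1+n)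
open import Data.Nat.DivMod using (_%_; _/_; m≡m%n+[m/n]*n; m%n<n)
open import Data.Fin as Fin using (Fin; toℕ)
open import Data.Fin.Properties using (_≟_; pigeonhole; toℕ<n)
open import Data.Fin.Permutation using (Permutation′; _⟨$⟩ʳ_; _⟨$⟩ˡ_; inverseˡ)
open import Data.List using (List; []; _∷_; _++_; [_]; map; upTo; takeWhile; applyUpTo; concatMap)
open import Data.List.Properties using (map-upTo; ++-assoc)
open import Data.List.Membership.Propositional using (_∈_; _∉_)
open import Data.List.Membership.Propositional.Properties using (∈-++⁺ˡ; ∈-++⁺ʳ; ∈-++⁻; ∈-applyUpTo⁺; ∈-applyUpTo⁻)
open import Data.List.Relation.Unary.All as All using (All; []; _∷_; all?)
import Data.List.Relation.Unary.All.Properties as All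
open import Data.List.Relation.Unary.Any as Any using (Any; here; there)
import Data.List.Relation.Unary.Any.Properties as Any
open import Data.List.Relation.Unary.AllPairs as AllPairs using (AllPairs; []; _∷_)
import Data.List.Relation.Unary.AllPairs.Properties as AllPairs
open import Data.Product using (∃-syntax; _×_; _,_; proj₁; proj₂; swap)
open import Data.Sum using (_⊎_; inj₁; inj₂; [_,_]′)
open import Data.Unit using (⊤)
open import Data.Empty using (⊥-elim)
open import Function using (_∘_; id)
open import Relation.Nullary using (¬_; yes; no; ¬?)
open import Relation.Unary using (Pred) renaming (Decidable to Decidable₁)
open import Relation.Binary using (Rel; IsPartialOrder; tri<; tri≈; tri>)
open import Relation.Binary.PropositionalEquality using (_≡_; _≢_; refl; sym; trans; cong; subst; subst₂; module ≡-Reasoning)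
open import Relation.Binary.Construct.Closure.ReflexiveTransitive using (ε; _◅_; _◅◅_)

least-witness : {D : ℕ → Set} → Decidable₁ D → ∀ {m} → D m →
                ∃[ k ] (k ≤ m × D k × (∀ {j} → j < k → ¬ D j))
least-witness D? {m} d with D? 0
... | yes d₀ = 0 , z≤n , d₀ , λ ()
least-witness D? {zero}  d | no ¬d₀ = ⊥-elim (¬d₀ d)
least-witness D? {suc m} d | no ¬d₀ with least-witness (D? ∘ suc) d
... | k , k≤m , dk , below = suc k , s≤s k≤m , dk , λ { {zero} _ → ¬d₀ ; {suc j} (s≤s j<k) → below j<k }

module _ {A : Set} {Q : Pred A 0ℓ} (Q? : Decidable₁ Q) where

  takeWhile-applyUpTo : ∀ (g : ℕ → A) {p m} → p < m → (∀ {k} → k < p → Q (g k)) → ¬ Q (g p) →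
                        takeWhile Q? (applyUpTo g m) ≡ applyUpTo g p
  takeWhile-applyUpTo g {p} {suc m} p<m before stop with Q? (g 0)
  takeWhile-applyUpTo g {zero}  {suc m} _ _ stop | yes q = ⊥-elim (stop q)
  takeWhile-applyUpTo g {suc p} {suc m} (s≤s p<m) before stop | yes q =
    cong (g 0 ∷_) (takeWhile-applyUpTo (g ∘ suc) p<m (before ∘ s≤s) stop)
  takeWhile-applyUpTo g {zero}  {suc m} _ _ _ | no _ = refl
  takeWhile-applyUpTo g {suc p} {suc m} _ before _ | no ¬q = ⊥-elim (¬q (before z<s))

module _ {A : Set} {R S : Rel A 0ℓ} where

  AllPairs-mapWithAll : {U : Pred A 0ℓ} {xs : List A} → (∀ {x y} → U x → U y → R x y → S x y) →
                        All U xs → AllPairs R xs → AllPairs S xs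
  AllPairs-mapWithAll f [] [] = []
  AllPairs-mapWithAll f (ux ∷ us) (rx ∷ rs) =
    All.zipWith (λ (uy , rxy) → f ux uy rxy) (us , rx) ∷ AllPairs-mapWithAll f us rs

module Cycles {n : ℕ} (τ : Permutation′ n) where

  τ^ : ℕ → Fin n → Fin n
  τ^ = iter (τ ⟨$⟩ʳ_)

  τ^-+ : ∀ a b x → τ^ (a + b) x ≡ τ^ a (τ^ b x)
  τ^-+ zero    b x = refl
  τ^-+ (suc a) b x = cong (τ ⟨$⟩ʳ_) (τ^-+ a b x)

  τ^-injective : ∀ a {x y} → τ^ a x ≡ τ^ a y → x ≡ y
  τ^-injective zero    eq = eq
  τ^-injective (suc a) {x} {y} eq = τ^-injective a (begin
    τ^ a x                       ≡⟨ inverseˡ τ ⟨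
    τ ⟨$⟩ˡ (τ ⟨$⟩ʳ τ^ a x)       ≡⟨ cong (τ ⟨$⟩ˡ_) eq ⟩
    τ ⟨$⟩ˡ (τ ⟨$⟩ʳ τ^ a y)       ≡⟨ inverseˡ τ ⟩
    τ^ a y                       ∎)
    where open ≡-Reasoning

  τ^-periodic : ∀ {p x} → τ^ p x ≡ x → ∀ q → τ^ (q * p) x ≡ x
  τ^-periodic         ret zero    = refl
  τ^-periodic {p} {x} ret (suc q) = trans (τ^-+ p (q * p) x) (trans (cong (τ^ p) (τ^-periodic ret q)) ret)

  return-after-collision : ∀ {i j x} → i < j → τ^ i x ≡ τ^ j x → ∃[ o ] (i + suc o ≡ j × τ^ (suc o) x ≡ x)
  return-after-collision {i} {x = x} i<j eq with m≤n⇒∃[o]m+o≡n i<j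
  ... | o , refl = o , +-suc i o , τ^-injective i (begin
    τ^ i (τ^ (suc o) x)  ≡⟨ τ^-+ i (suc o) x ⟨
    τ^ (i + suc o) x     ≡⟨ cong (λ t → τ^ t x) (+-suc i o) ⟩
    τ^ (suc i + o) x     ≡⟨ eq ⟨
    τ^ i x               ∎)
    where open ≡-Reasoning

  returns : ∀ x → ∃[ p ] (p < n × τ^ (suc p) x ≡ x)
  returns x with pigeonhole (n<1+n n) (λ i → τ^ (toℕ i) x)
  ... | i , j , i<j , eq with return-after-collision i<j eq
  ...   | o , i+1+o≡j , ret = o , p<n , ret
    where
    p<n : o < n
    p<n = ≤-trans (m≤n+m (suc o) (toℕ i)) (≤-pred (subst (_< suc n) (sym i+1+o≡j) (toℕ<n j)))

  -- the cycle of x has length suc ℓ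
  record CycleLength (x : Fin n) : Set where
    field
      ℓ               : ℕ
      ℓ<n             : ℓ < n
      returns-after   : τ^ (suc ℓ) x ≡ x
      no-early-return : ∀ {k} → k < ℓ → τ^ (suc k) x ≢ x

  cycleLength : ∀ x → CycleLength x
  cycleLength x with returns x
  ... | p , p<n , ret with least-witness (λ k → τ^ (suc k) x ≟ x) ret
  ...   | ℓ , ℓ≤p , retℓ , below = record
    { ℓ = ℓ ; ℓ<n = ≤-trans (s≤s ℓ≤p) p<n ; returns-after = retℓ ; no-early-return = below }

  module _ (x : Fin n) where
    open CycleLength (cycleLength x)

    cycleWord≡applyUpTo : cycleWord τ x ≡ applyUpTo (λ k → τ^ k x) (suc ℓ)
    cycleWord≡applyUpTo = cong (x ∷_) (begin
      takeWhile Q? (map g (upTo n))  ≡⟨ cong (takeWhile Q?) (map-upTo g n) ⟩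
      takeWhile Q? (applyUpTo g n)   ≡⟨ takeWhile-applyUpTo Q? g ℓ<n no-early-return (λ ne → ne returns-after) ⟩
      applyUpTo g ℓ                  ∎)
      where
      open ≡-Reasoning
      g : ℕ → Fin n
      g k = τ^ (suc k) x
      Q? : Decidable₁ (λ y → ¬ y ≡ x)
      Q? y = ¬? (y ≟ x)

    τ^-reduce : ∀ m → τ^ m x ≡ τ^ (m % suc ℓ) x
    τ^-reduce m = begin
      τ^ m x                                       ≡⟨ cong (λ t → τ^ t x) (m≡m%n+[m/n]*n m (suc ℓ)) ⟩
      τ^ (m % suc ℓ + (m / suc ℓ) * suc ℓ) x       ≡⟨ τ^-+ (m % suc ℓ) _ x ⟩
      τ^ (m % suc ℓ) (τ^ ((m / suc ℓ) * suc ℓ) x)  ≡⟨ cong (τ^ (m % suc ℓ)) (τ^-periodic returns-after (m / suc ℓ)) ⟩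
      τ^ (m % suc ℓ) x                             ∎
      where open ≡-Reasoning

    τ^-distinct : ∀ {i j} → i < j → j < suc ℓ → τ^ i x ≢ τ^ j x
    τ^-distinct {i} i<j j≤ℓ eq with return-after-collision i<j eq
    ... | o , i+1+o≡j , ret = no-early-return (≤-trans (m≤n+m (suc o) i) (subst (_≤ ℓ) (sym i+1+o≡j) (≤-pred j≤ℓ))) ret

  SameCycle-refl : ∀ {x} → SameCycle τ x x
  SameCycle-refl = 0 , refl

  SameCycle-trans : ∀ {x y z} → SameCycle τ x y → SameCycle τ y z → SameCycle τ x z
  SameCycle-trans {x} (a , refl) (b , refl) = b + a , τ^-+ b a x

  SameCycle-sym : ∀ {x y} → SameCycle τ x y → SameCycle τ y x
  SameCycle-sym {x} (m , refl) = m * ℓ , (begin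
    τ^ (m * ℓ) (τ^ m x)   ≡⟨ τ^-+ (m * ℓ) m x ⟨
    τ^ (m * ℓ + m) x      ≡⟨ cong (λ t → τ^ t x) (trans (+-comm (m * ℓ) m) (sym (*-suc m ℓ))) ⟩
    τ^ (m * suc ℓ) x      ≡⟨ τ^-periodic returns-after m ⟩
    x                     ∎)
    where
    open ≡-Reasoning
    open CycleLength (cycleLength x)

  ∈-cycleWord⁻ : ∀ {x y} → y ∈ cycleWord τ x → SameCycle τ x y
  ∈-cycleWord⁻ {x} {y} y∈ with ∈-applyUpTo⁻ (λ k → τ^ k x) (subst (y ∈_) (cycleWord≡applyUpTo x) y∈)
  ... | k , _ , y≡τ^k = k , sym y≡τ^k

  ∈-cycleWord⁺ : ∀ {x y} → SameCycle τ x y → y ∈ cycleWord τ x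
  ∈-cycleWord⁺ {x} (m , refl) = subst (τ^ m x ∈_) (sym (cycleWord≡applyUpTo x))
    (subst (_∈ applyUpTo (λ k → τ^ k x) (suc ℓ)) (sym (τ^-reduce x m)) (∈-applyUpTo⁺ (λ k → τ^ k x) (m%n<n m (suc ℓ))))
    where open CycleLength (cycleLength x)

  cycleWord-distinct : ∀ x → AllPairs _≢_ (cycleWord τ x)
  cycleWord-distinct x = subst (AllPairs _≢_) (sym (cycleWord≡applyUpTo x))
    (AllPairs.applyUpTo⁺₁ (λ k → τ^ k x) (suc ℓ) (τ^-distinct x))
    where open CycleLength (cycleLength x)

module LevelsOfPermutation {n : ℕ} (P : FinPoset n) (τ : Permutation′ n) where
  open Cycles τ

  SameCycle⇒≼ : ∀ {x y} → SameCycle τ x y → _≼_ P τ x y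
  SameCycle⇒≼ {y = y} sc = (y , y , sc , SameCycle-refl , IsPartialOrder.refl (isPartialOrder P)) ◅ ε

  DeletedT-resp : ∀ k {x y} → _≼_ P τ x y → _≼_ P τ y x → DeletedT P τ k x → DeletedT P τ k y
  LevelT-resp   : ∀ k {x y} → _≼_ P τ x y → _≼_ P τ y x → LevelT P τ k x → LevelT P τ k y
  DeletedT-resp (suc k) x≼y y≼x (inj₁ d) = inj₁ (DeletedT-resp k x≼y y≼x d)
  DeletedT-resp (suc k) x≼y y≼x (inj₂ l) = inj₂ (LevelT-resp (suc k) x≼y y≼x l)
  LevelT-resp (suc k) x≼y y≼x (x-undeleted , x-minimal) =
    x-undeleted ∘ DeletedT-resp k y≼x x≼y ,
    λ z (z≼y , y⋠z) → x-minimal z (z≼y ◅◅ y≼x , λ x≼z → y⋠z (y≼x ◅◅ x≼z))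

  LevelT-SameCycle : ∀ {k x y} → SameCycle τ x y → LevelT P τ k x → LevelT P τ k y
  LevelT-SameCycle sc = LevelT-resp _ (SameCycle⇒≼ sc) (SameCycle⇒≼ (SameCycle-sym sc))

  DeletedT-mono : ∀ {k m x} → k ≤ m → DeletedT P τ k x → DeletedT P τ m x
  DeletedT-mono k≤m d with m≤n⇒m<n∨m≡n k≤m
  ... | inj₂ refl = d
  DeletedT-mono {m = suc m} _ d | inj₁ (s≤s k≤m) = inj₁ (DeletedT-mono k≤m d)

  LevelT-unique : ∀ {k m x} → LevelT P τ k x → LevelT P τ m x → k ≡ m
  LevelT-unique {suc k} {suc m} lk lm with <-cmp k m
  ... | tri≈ _ k≡m _ = cong suc k≡m
  ... | tri< k<m _ _ = ⊥-elim (proj₁ lm (DeletedT-mono k<m (inj₂ lk)))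
  ... | tri> _ _ m<k = ⊥-elim (proj₁ lk (DeletedT-mono m<k (inj₂ lm)))

  LevelT-positive : ∀ {k x} → LevelT P τ k x → 1 ≤ k
  LevelT-positive {suc k} _ = s≤s z≤n

  module _ (pitchfork : InSPitchfork P τ) where

    sameLevel-≰ : ∀ {k a b} → LevelT P τ k a → LevelT P τ k b → a ≢ b → ¬ _≤P_ P a b
    sameLevel-≰ {suc k} {a} {b} (a-undeleted , _) (_ , b-minimal) a≢b a≤b =
      a-undeleted (b-minimal a (a≼b , λ b≼a → a≢b (proj₁ pitchfork a b (proj₂ pitchfork a b a≼b b≼a) a≤b)))
      where
      a≼b : _≼_ P τ a b
      a≼b = (a , b , SameCycle-refl , SameCycle-refl , a≤b) ◅ ε

    sameLevel⇒incomparable : ∀ {k a b} → LevelT P τ k a → LevelT P τ k b → a ≢ b → Incomparable P a b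
    sameLevel⇒incomparable la lb a≢b = sameLevel-≰ la lb a≢b , sameLevel-≰ lb la (a≢b ∘ sym)

nth-levelsL : ∀ {n} (P : FinPoset n) xs j → nth P (levelsL P xs) j ≡ nth P (levelsGo P [] xs) j
nth-levelsL P []      zero    = refl
nth-levelsL P []      (suc j) = refl
nth-levelsL P (x ∷ xs) j      = refl

module GreedyLevels {n : ℕ} (P : FinPoset n) (lev : Fin n → ℕ) (W : List (Fin n)) where

  Comparable : Rel (Fin n) 0ℓ
  Comparable y b = _≤P_ P y b ⊎ _≤P_ P b y

  LevelOrdered : Rel (Fin n) 0ℓ
  LevelOrdered a b = lev a ≤ lev b × (lev a ≡ lev b → Incomparable P a b)

  RisesWitnessed : ℕ → List (Fin n) → Set
  RisesWitnessed c []       = ⊤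
  RisesWitnessed c (b ∷ bs) =
    (c < lev b → ∃[ y ] (y ∈ W × suc (lev y) ≡ lev b × Comparable y b)) × RisesWitnessed (lev b) bs

  RisesWitnessed-++ : ∀ {c ws rest} → All (λ w → lev w ≡ c) ws → RisesWitnessed c rest → RisesWitnessed c (ws ++ rest)
  RisesWitnessed-++ []            rw = rw
  RisesWitnessed-++ (refl ∷ ws≡c) rw = (λ c<c → ⊥-elim (<-irrefl refl c<c)) , RisesWitnessed-++ ws≡c rw

  RisesWitnessed-block : ∀ {c b ws rest} → All (λ w → lev w ≡ lev b) (b ∷ ws) →
                         (c < lev b → ∃[ y ] (y ∈ W × suc (lev y) ≡ lev b × Comparable y b)) →
                         RisesWitnessed (lev b) rest → RisesWitnessed c ((b ∷ ws) ++ rest)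
  RisesWitnessed-block (_ ∷ ws≡b) rise rw = rise , RisesWitnessed-++ ws≡b rw

  LevelBlocks : ℕ → List (Fin n) → List (List (Fin n)) → Set
  LevelBlocks c zs L = ∀ j x → (x ∈ nth P L j → x ∈ zs × lev x ≡ j + c) × (x ∈ zs → lev x ≡ j + c → x ∈ nth P L j)

  LevelBlocks-[] : ∀ c → LevelBlocks c [] []
  LevelBlocks-[] c j x = (λ ()) , (λ ())

  LevelBlocks-∷ : ∀ {c acc zs L} → All (λ a → lev a ≡ c) acc → All (λ z → c < lev z) zs →
                  LevelBlocks (suc c) zs L → LevelBlocks c (acc ++ zs) (acc ∷ L)
  LevelBlocks-∷ {c} {acc} acc≡c zs>c blocks zero x =
    (λ x∈acc → ∈-++⁺ˡ x∈acc , All.lookup acc≡c x∈acc) ,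
    (λ x∈ x≡c → [ id , (λ x∈zs → ⊥-elim (<-irrefl (sym x≡c) (All.lookup zs>c x∈zs))) ]′ (∈-++⁻ acc x∈))
  LevelBlocks-∷ {c} {acc} {zs} acc≡c zs>c blocks (suc j) x =
    (λ x∈L → let x∈zs , x≡ = proj₁ (blocks j x) x∈L in ∈-++⁺ʳ acc x∈zs , trans x≡ (+-suc j c)) ,
    (λ x∈ x≡ → proj₂ (blocks j x) (in-zs x∈ x≡) (trans x≡ (sym (+-suc j c))))
    where
    in-zs : x ∈ acc ++ zs → lev x ≡ suc j + c → x ∈ zs
    in-zs x∈ x≡ = [ (λ x∈acc → ⊥-elim (m≢1+n+m c (trans (sym (All.lookup acc≡c x∈acc)) x≡))) , id ]′ (∈-++⁻ acc x∈)

  record GoInvariant (c : ℕ) (acc rest : List (Fin n)) : Set where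
    field
      acc-level       : All (λ a → lev a ≡ c) acc
      rest-above      : All (λ b → c ≤ lev b) rest
      rest-ordered    : AllPairs LevelOrdered rest
      acc-before-rest : All (λ a → All (LevelOrdered a) rest) acc
      witnessed       : RisesWitnessed c rest
      complete        : ∀ {y} → y ∈ W → c ≤ lev y → y ∈ acc ⊎ y ∈ rest

  module Step {c acc b rest} (inv : GoInvariant c acc (b ∷ rest)) where
    open GoInvariant inv

    b-before-rest : All (LevelOrdered b) rest
    b-before-rest with rest-ordered
    ... | b-row ∷ _ = b-row

    b-lowest : ∀ {y} → y ∈ b ∷ rest → lev b ≤ lev y
    b-lowest (here refl) = ≤-refl
    b-lowest (there y∈) = proj₁ (All.lookup b-before-rest y∈)

    -- The witness of the rise sits at level ≥ c, so it is still in acc or ahead; it cannot be ahead,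
    -- being below b.
    rise-is-by-one : c < lev b → lev b ≡ suc c × ¬ All (Incomparable P b) acc
    rise-is-by-one c<b with proj₁ witnessed c<b
    ... | y , y∈W , y+1≡b , y~b with complete y∈W (≤-pred (subst (c <_) (sym y+1≡b) c<b))
    ...   | inj₂ y∈ = ⊥-elim (<⇒≱ (subst (lev y <_) y+1≡b ≤-refl) (b-lowest y∈))
    ...   | inj₁ y∈acc = trans (sym y+1≡b) (cong suc (All.lookup acc-level y∈acc)) ,
                         λ b∥acc → let b∥y = All.lookup b∥acc y∈acc in [ proj₂ b∥y , proj₁ b∥y ]′ y~b

    stay-is-incomparable : lev b ≡ c → All (Incomparable P b) acc
    stay-is-incomparable b≡c = All.zipWith (λ (a≡c , a-row) → swap (proj₂ (All.head a-row) (trans a≡c (sym b≡c))))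
                                           (acc-level , acc-before-rest)

    level-if-incomparable : All (Incomparable P b) acc → lev b ≡ c
    level-if-incomparable b∥acc with m≤n⇒m<n∨m≡n (All.head rest-above)
    ... | inj₁ c<b = ⊥-elim (proj₂ (rise-is-by-one c<b) b∥acc)
    ... | inj₂ c≡b = sym c≡b

    level-if-comparable : ¬ All (Incomparable P b) acc → lev b ≡ suc c
    level-if-comparable ¬b∥acc with m≤n⇒m<n∨m≡n (All.head rest-above)
    ... | inj₁ c<b = proj₁ (rise-is-by-one c<b)
    ... | inj₂ c≡b = ⊥-elim (¬b∥acc (stay-is-incomparable (sym c≡b)))

    rest-above-next : lev b ≡ suc c → All (λ z → c < lev z) rest
    rest-above-next b≡c+1 = All.map (λ {z} b-z → subst (_≤ lev z) b≡c+1 (proj₁ b-z)) b-before-rest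

    extend : lev b ≡ c → GoInvariant c (acc ++ [ b ]) rest
    extend b≡c = record
      { acc-level       = All.++⁺ acc-level (b≡c ∷ [])
      ; rest-above      = All.tail rest-above
      ; rest-ordered    = AllPairs.tail rest-ordered
      ; acc-before-rest = All.++⁺ (All.map All.tail acc-before-rest) (b-before-rest ∷ [])
      ; witnessed       = subst (λ t → RisesWitnessed t rest) b≡c (proj₂ witnessed)
      ; complete        = λ y∈W c≤y → [ inj₁ ∘ ∈-++⁺ˡ , shift ]′ (complete y∈W c≤y)
      }
      where
      shift : ∀ {y} → y ∈ b ∷ rest → y ∈ acc ++ [ b ] ⊎ y ∈ rest
      shift (here refl) = inj₁ (∈-++⁺ʳ acc (here refl))
      shift (there y∈)  = inj₂ y∈

    advance : lev b ≡ suc c → GoInvariant (suc c) [ b ] rest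
    advance b≡c+1 = record
      { acc-level       = b≡c+1 ∷ []
      ; rest-above      = rest-above-next b≡c+1
      ; rest-ordered    = AllPairs.tail rest-ordered
      ; acc-before-rest = b-before-rest ∷ []
      ; witnessed       = subst (λ t → RisesWitnessed t rest) b≡c+1 (proj₂ witnessed)
      ; complete        = λ y∈W c<y → [ (⊥-elim ∘ below c<y) , split ]′ (complete y∈W (<⇒≤ c<y))
      }
      where
      below : ∀ {y} → c < lev y → y ∉ acc
      below c<y y∈acc = <-irrefl (sym (All.lookup acc-level y∈acc)) c<y
      split : ∀ {y} → y ∈ b ∷ rest → y ∈ [ b ] ⊎ y ∈ rest
      split (here refl) = inj₁ (here refl)
      split (there y∈)  = inj₂ y∈

  levelsGo-blocks : ∀ {c acc rest} → GoInvariant c acc rest → LevelBlocks c (acc ++ rest) (levelsGo P acc rest)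
  levelsGo-blocks {c} {acc} {[]} inv = LevelBlocks-∷ (GoInvariant.acc-level inv) [] (LevelBlocks-[] (suc c))
  levelsGo-blocks {c} {acc} {b ∷ rest} inv with all? (incomparable? P b) acc
  ... | yes b∥acc = subst (λ zs → LevelBlocks c zs (levelsGo P (acc ++ [ b ]) rest)) (++-assoc acc [ b ] rest)
                      (levelsGo-blocks (Step.extend inv (Step.level-if-incomparable inv b∥acc)))
  ... | no ¬b∥acc = LevelBlocks-∷ (GoInvariant.acc-level inv) (≤-reflexive (sym b≡c+1) ∷ Step.rest-above-next inv b≡c+1)
                      (levelsGo-blocks (Step.advance inv b≡c+1))
    where
    b≡c+1 : lev b ≡ suc c
    b≡c+1 = Step.level-if-comparable inv ¬b∥acc

  levelsL-blocks : AllPairs LevelOrdered W → RisesWitnessed 1 W → All (λ a → 1 ≤ lev a) W →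
                   ∀ j x → (x ∈ nth P (levelsL P W) j → x ∈ W × lev x ≡ suc j) × (x ∈ W → lev x ≡ suc j → x ∈ nth P (levelsL P W) j)
  levelsL-blocks ordered witnessed positive j x rewrite nth-levelsL P W j | +-comm 1 j =
    levelsGo-blocks initial j x
    where
    initial : GoInvariant 1 [] W
    initial = record
      { acc-level = [] ; rest-above = positive ; rest-ordered = ordered ; acc-before-rest = []
      ; witnessed = witnessed ; complete = λ y∈W _ → inj₂ y∈W }

module PhiLevels {n : ℕ} {P : FinPoset n} {τ : Permutation′ n} (pitchfork : InSPitchfork P τ)
                 {es : List (Fin n)} (leaders : All (IsLeader P τ) es)
                 (cover : ∀ x → Any (SameCycle τ x) es) (written : AllPairs (WrittenBefore P τ) es) where
  open Cycles τ
  open LevelsOfPermutation P τ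

  Φ : List (Fin n)
  Φ = concatMap (cycleWord τ) es

  ∈-Φ : ∀ x → x ∈ Φ
  ∈-Φ x = Any.concat⁺ (Any.map⁺ (Any.map (∈-cycleWord⁺ ∘ SameCycle-sym) (cover x)))

  Essential⇒LevelT : ∀ {e} → Essential P τ e → ∃[ k ] LevelT P τ k e
  Essential⇒LevelT (inj₁ l)          = 1 , l
  Essential⇒LevelT (inj₂ (k , l , _)) = suc (suc k) , l

  LevelT-exists : ∀ x → ∃[ k ] LevelT P τ k x
  LevelT-exists x with All.lookupAny leaders (cover x)
  ... | (essential , _) , x~e with Essential⇒LevelT essential
  ...   | k , l = k , LevelT-SameCycle (SameCycle-sym x~e) l

  level : Fin n → ℕ
  level = proj₁ ∘ LevelT-exists

  level-LevelT : ∀ x → LevelT P τ (level x) x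
  level-LevelT = proj₂ ∘ LevelT-exists

  level-unique : ∀ {k x} → LevelT P τ k x → level x ≡ k
  level-unique = LevelT-unique (level-LevelT _)

  level-SameCycle : ∀ {x y} → SameCycle τ x y → level x ≡ level y
  level-SameCycle {x} x~y = sym (level-unique (LevelT-SameCycle x~y (level-LevelT x)))

  open GreedyLevels P level Φ

  Ascending : Rel (Fin n) 0ℓ
  Ascending a b = level a ≤ level b × a ≢ b

  Ascending⇒LevelOrdered : ∀ {a b} → Ascending a b → LevelOrdered a b
  Ascending⇒LevelOrdered {a} {b} (a≤b , a≢b) = a≤b , λ a≡b →
    sameLevel⇒incomparable pitchfork (level-LevelT a) (subst (λ k → LevelT P τ k b) (sym a≡b) (level-LevelT b)) a≢b

  cycleWord-level : ∀ e → All (λ a → level a ≡ level e) (cycleWord τ e)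
  cycleWord-level e = All.tabulate (sym ∘ level-SameCycle ∘ ∈-cycleWord⁻)

  cycleWord-ascending : ∀ e → AllPairs Ascending (cycleWord τ e)
  cycleWord-ascending e =
    AllPairs-mapWithAll (λ a≡e b≡e a≢b → ≤-reflexive (trans a≡e (sym b≡e)) , a≢b) (cycleWord-level e) (cycleWord-distinct e)

  cycleWords-ascending : ∀ {e₁ e₂} → IsLeader P τ e₁ → IsLeader P τ e₂ → WrittenBefore P τ e₁ e₂ →
                         All (λ a → All (Ascending a) (cycleWord τ e₂)) (cycleWord τ e₁)
  cycleWords-ascending {e₁} {e₂} (_ , e₁-largest) (e₂-essential , _) e₁-first =
    All.tabulate λ a∈ → All.tabulate λ b∈ → ascending (∈-cycleWord⁻ a∈) (∈-cycleWord⁻ b∈)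
    where
    order : level e₁ < level e₂ ⊎ (level e₁ ≡ level e₂ × e₁ Fin.< e₂)
    order = e₁-first (level e₁) (level e₂) (level-LevelT e₁) (level-LevelT e₂)

    different-cycles : ¬ SameCycle τ e₁ e₂
    different-cycles e₁~e₂ with order
    ... | inj₁ e₁<e₂       = <-irrefl (level-SameCycle e₁~e₂) e₁<e₂
    ... | inj₂ (_ , e₁<e₂) = <⇒≱ e₁<e₂ (e₁-largest e₂ e₁~e₂ e₂-essential)

    ascending : ∀ {a b} → SameCycle τ e₁ a → SameCycle τ e₂ b → Ascending a b
    ascending e₁~a e₂~b =
      subst₂ _≤_ (level-SameCycle e₁~a) (level-SameCycle e₂~b) ([ <⇒≤ , ≤-reflexive ∘ proj₁ ]′ order) ,
      λ { refl → different-cycles (SameCycle-trans e₁~a (SameCycle-sym e₂~b)) }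

  Φ-ordered : AllPairs LevelOrdered Φ
  Φ-ordered = AllPairs.map Ascending⇒LevelOrdered
    (AllPairs.concat⁺ (All.map⁺ (All.tabulate (λ {e} _ → cycleWord-ascending e)))
                      (AllPairs.map⁺ (AllPairs-mapWithAll cycleWords-ascending leaders written)))

  essential-rise-witnessed : ∀ {p e} → 1 ≤ p → Essential P τ e → p < level e →
                             ∃[ y ] (y ∈ Φ × suc (level y) ≡ level e × Comparable y e)
  essential-rise-witnessed 1≤p (inj₁ l₁) p<e = ⊥-elim (<⇒≱ p<e (subst (_≤ _) (sym (level-unique l₁)) 1≤p))
  essential-rise-witnessed _ (inj₂ (_ , l , y , l-y , y<e)) _ =
    y , ∈-Φ y , trans (cong suc (level-unique l-y)) (sym (level-unique l)) , inj₁ (proj₁ y<e)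

  cycleWords-risesWitnessed : ∀ {p} es′ → 1 ≤ p → All (IsLeader P τ) es′ → RisesWitnessed p (concatMap (cycleWord τ) es′)
  cycleWords-risesWitnessed []        _   []                    = _
  cycleWords-risesWitnessed (e ∷ es′) 1≤p ((essential , _) ∷ leaders′) =
    RisesWitnessed-block (cycleWord-level e) (essential-rise-witnessed 1≤p essential)
      (cycleWords-risesWitnessed es′ (LevelT-positive (level-LevelT e)) leaders′)

  Φ-positive : All (λ a → 1 ≤ level a) Φ
  Φ-positive = All.tabulate (λ {x} _ → LevelT-positive (level-LevelT x))

  Φ-blocks : ∀ j x → (x ∈ nth P (levelsL P Φ) j → level x ≡ suc j) × (level x ≡ suc j → x ∈ nth P (levelsL P Φ) j)
  Φ-blocks j x = proj₂ ∘ proj₁ blocks , proj₂ blocks (∈-Φ x)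
    where
    blocks : (x ∈ nth P (levelsL P Φ) j → x ∈ Φ × level x ≡ suc j) × (x ∈ Φ → level x ≡ suc j → x ∈ nth P (levelsL P Φ) j)
    blocks = levelsL-blocks Φ-ordered (cycleWords-risesWitnessed es ≤-refl leaders) Φ-positive j x

lemma3p10 : (n : ℕ) (P : FinPoset n) (τ : Permutation′ n) →
    InSPitchfork P τ →
    (σ : List (Fin n)) → IsΦ P τ σ →
    (k : ℕ) → 1 ≤ k → (x : Fin n) →
    (LevelT P τ k x → LevelS P σ k x) × (LevelS P σ k x → LevelT P τ k x)
lemma3p10 n P τ pitchfork σ (es , refl , leaders , cover , written) (suc j) _ x =
  (λ x∈Level → proj₂ (Φ-blocks j x) (level-unique x∈Level)) ,
  (λ x∈Level → subst (λ k → LevelT P τ k x) (proj₁ (Φ-blocks j x) x∈Level) (level-LevelT x))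
  where open PhiLevels pitchfork leaders cover written
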